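{- Let the Mathieu group $M_{12}$ act on its $12$-point set $\Omega$ and let $F\in\Omega$ be any fixed point chosen as distinguished element. Then (a) $hd((M_{12})^{\triangle}_{ - })\ge 6$; (b) $M(11,6)\ge |M_{12}|=95040$; (c) $M(10,6)\ge 8640$.
   Context: $M_{12}$ is the Mathieu group of degree $12$, a sharply $5$-transitive permutation group of order $95040$. For permutations $\pi,\sigma$, $hd(\pi,\sigma)=|\{x:\pi(x)\neq\sigma(x)\}|$; for a set $A$ of permutations, $hd(A)$ is the minimum of $hd(\pi,\sigma)$ over distinct $\pi,\sigma\in A$. For a permutation $\pi$ of $\Omega$, $\pi^{\triangle}$ is defined by $\pi^{\triangle}(\pi^{ -1}(F))=\pi(F)$, $\pi^{\triangle}(F)=F$, $\pi^{\triangle}(x)=\pi(x)$ otherwise; $\pi^{\triangle}_{ - }$ is the restriction of $\pi^{\triangle}$ to $\Omega\setminus\{F\}$; for a set $S$ of permutations, $S^{\triangle}_{ - }=\{\pi^{\triangle}_{ - }:\pi\in S\}$. $M(n,d)$ is the maximum cardinality of a set of permutations of an $n$-element set with pairwise Hamming distance at least $d$. -}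

module Defs where

open import Data.Nat using (ℕ; _≤_)
open import Data.Fin as Fin using (Fin; _≟_; #_)
open import Data.Fin.Permutation using (Permutation′; _⟨$⟩ʳ_; _⟨$⟩ˡ_; _∘ₚ_; transpose; id; _≈_)
open import Data.List using (List; []; _∷_; foldr; filter; length; allFin)
open import Data.List.Relation.Unary.AllPairs using (AllPairs)
open import Data.Product using (∃; _×_)
open import Relation.Nullary using (¬_; ¬?; does)
open import Data.Bool using (if_then_else_)

hdOn : {n : ℕ} → List (Fin n) → (Fin n → Fin n) → (Fin n → Fin n) → ℕ
hdOn D f g = length (filter (λ x → ¬? (f x ≟ g x)) D)

hd : {n : ℕ} → Permutation′ n → Permutation′ n → ℕ
hd π σ = hdOn (allFin _) (π ⟨$⟩ʳ_) (σ ⟨$⟩ʳ_)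

-- "M(n,d) ≥ k": there is a set (a list whose entries are pairwise at
-- Hamming distance ≥ d) of at least k permutations of an n-element set.
MAtLeast : ℕ → ℕ → ℕ → Set
MAtLeast n d k =
  ∃ λ (C : List (Permutation′ n)) → k ≤ length C × AllPairs (λ π σ → d ≤ hd π σ) C

-- Cycle (a b₁ b₂ … bₖ) as a product of transpositions
-- ((π ∘ₚ ρ) applies π first).
cycle : {n : ℕ} → Fin n → List (Fin n) → Permutation′ n
cycle a bs = foldr (λ b p → transpose a b ∘ₚ p) id bs

-- Generators of M₁₂ (GAP's MathieuGroup(12)), with GAP point i
-- represented by Fin element i - 1:
--   (1,2,3,4,5,6,7,8,9,10,11), (3,7,11,8)(4,10,5,6),
--   (1,12)(2,11)(3,6)(4,8)(5,9)(7,10)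
c12 : Fin 12 → List (Fin 12) → Permutation′ 12
c12 = cycle

t12 : Fin 12 → Fin 12 → Permutation′ 12
t12 = transpose

gen : Fin 3 → Permutation′ 12
gen Fin.zero = c12 (# 0) ((# 1) ∷ (# 2) ∷ (# 3) ∷ (# 4) ∷ (# 5) ∷ (# 6) ∷ (# 7) ∷ (# 8) ∷ (# 9) ∷ (# 10) ∷ [])
gen (Fin.suc Fin.zero) = c12 (# 2) ((# 6) ∷ (# 10) ∷ (# 7) ∷ []) ∘ₚ c12 (# 3) ((# 9) ∷ (# 4) ∷ (# 5) ∷ [])
gen (Fin.suc (Fin.suc Fin.zero)) =
  t12 (# 0) (# 11) ∘ₚ t12 (# 1) (# 10) ∘ₚ t12 (# 2) (# 5) ∘ₚ
  t12 (# 3) (# 7) ∘ₚ t12 (# 4) (# 8) ∘ₚ t12 (# 6) (# 9)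

evalWord : List (Fin 3) → Permutation′ 12
evalWord w = foldr (λ i p → gen i ∘ₚ p) id w

-- Membership in M₁₂ = the subgroup of Sym(Fin 12) generated by the gens
-- (finite, so the generated monoid is the generated group).
InM12 : Permutation′ 12 → Set
InM12 π = ∃ λ (w : List (Fin 3)) → π ≈ evalWord w

tri : {n : ℕ} → Fin n → Permutation′ n → Fin n → Fin n
tri F π x =
  if does (x ≟ F) then F
  else (if does (x ≟ (π ⟨$⟩ˡ F)) then π ⟨$⟩ʳ F else π ⟨$⟩ʳ x)

minusPt : {n : ℕ} → Fin n → List (Fin n)
minusPt {n} F = filter (λ x → ¬? (x ≟ F)) (allFin n)

hdTriMinus : {n : ℕ} → Fin n → Permutation′ n → Permutation′ n → ℕ
hdTriMinus F π σ = hdOn (minusPt F) (tri F π) (tri F σ)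

-- A stabiliser chain of M₁₂ for the base 11, 10, 9, 8, 7, found with the Schreier–Sims
-- algorithm and verified by evaluation, shows that every element of M₁₂ factors
-- uniquely as a product of coset representatives, one for each level.  Hence M₁₂ is
-- sharply 5-transitive, its 12 · 11 · 10 · 9 · 8 = 95040 elements can be listed, and
-- the pointwise stabiliser of four points has order 8, so no element fixing four points
-- has a 3-cycle.
--
-- (a) Let π^△ and σ^△ agree at six points x ≠ F.  If π F = σ F, then π and σ agree at
-- these six points, so π = σ.  Otherwise π and σ agree at those of the six points that
-- differ from π⁻¹F and σ⁻¹F.  If one of π⁻¹F, σ⁻¹F is not among the six, that leaves
-- five agreements and again π = σ, which is absurd; if both are, then σ⁻¹π fixes four
-- points and contains the 3-cycle (F π⁻¹F σ⁻¹F), which is impossible.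
-- (b) By (a), the maps π^△₋ (F = 11) of the 95040 elements are pairwise at distance ≥ 6.
-- (c) π^△ fixes 10 exactly when π 10 is the image of 10 under the transposition of
-- π 11 and 11.  So for each of the 12 values of π 11 one coset of the pointwise
-- stabiliser of 11 and 10, of order 720, consists of such π, and deleting the common
-- fixed point 10 keeps all distances: 12 · 720 = 8640.

module Submission where

open import Defs
open import Agda.Builtin.FromNat using (Number; fromNat)
open import Data.Empty using (⊥; ⊥-elim)
open import Data.Unit using (tt)
open import Data.Bool using (true; false)
open import Data.Fin using (Fin; punchIn; _≟_)
import Data.Fin.Literals as FinLiterals
import Data.Nat.Literals as NatLiterals
open import Data.Fin.Properties using (all?; decFinSubset; punchIn-injective)
open import Data.Fin.Permutation
  using (Permutation′; _⟨$⟩ʳ_; _⟨$⟩ˡ_; _∘ₚ_; transpose; remove; inverseˡ; inverseʳ; punchIn-permute)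
import Data.Fin.Permutation.Components as PC
open import Data.List using (List; []; _∷_; _++_; length; filter; map; concatMap; allFin)
open import Data.List.Membership.Propositional using (_∈_; _∉_)
open import Data.List.Membership.Propositional.Properties using (∈-filter⁻)
open import Data.List.Relation.Unary.Any using (here; there)
open import Data.List.Relation.Unary.All as All using (All; []; _∷_)
import Data.List.Relation.Unary.All.Properties as All
open import Data.List.Relation.Unary.AllPairs as AllPairs using (AllPairs; []; _∷_)
import Data.List.Relation.Unary.AllPairs.Properties as AllPairs
open import Data.List.Properties using (length-++; length-map; filter-all; filter-≐; filter-++; filter-none)
open import Data.Nat as ℕ using (ℕ; zero; suc; _+_; _*_; _≤_; _≤?_; z≤n; s≤s)
open import Data.Nat.Properties
  using (+-suc; +-identityʳ; +-cancelʳ-≤; +-monoʳ-≤; m≤m+n; n≤1+n; ≤-refl; ≤-reflexive; ≤-trans; ≤-pred; ≰⇒>)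
open import Data.Product as Product using (∃; _×_; _,_; proj₁; proj₂)
open import Data.Vec as Vec using (Vec; []; _∷_; lookup)
open import Data.Vec.Properties using (map-∘; map-cong; map-id)
open import Data.Vec.Relation.Unary.All as VecAll using ([]; _∷_)
import Data.Vec.Relation.Unary.All.Properties as VecAll
open import Data.Vec.Relation.Unary.AllPairs as VecAllPairs using ([]; _∷_)
import Data.Vec.Relation.Unary.AllPairs.Properties as VecAllPairs
open import Data.Vec.Relation.Binary.Pointwise.Inductive using (Pointwise; []; _∷_; ≡⇒Pointwise-≡)
import Data.List.Relation.Unary.Unique.Propositional.Properties as Unique
open import Function using (id; _∘_)
open import Relation.Nullary using (¬_; Dec; yes; no; does; ¬?)
open import Relation.Nullary.Decidable as Dec
  using (from-yes; _×-dec_; _→-dec_; dec-true; dec-false; decidable-stable)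
open import Relation.Binary.PropositionalEquality
  using (_≡_; _≢_; _≗_; refl; sym; trans; cong; cong₂; subst; ≢-sym; module ≡-Reasoning)

instance
  natLiterals : Number ℕ
  natLiterals = NatLiterals.number

  finLiterals : ∀ {n} → Number (Fin n)
  finLiterals = FinLiterals.number _

open import Data.List.Membership.DecPropositional (_≟_ {12}) using (_∈?_; _∉?_)

allPairs-withAll : ∀ {A : Set} {P : A → Set} {R : A → A → Set} {xs} →
                   All P xs → AllPairs R xs → AllPairs (λ x y → P x × P y × R x y) xs
allPairs-withAll []         []         = []
allPairs-withAll (px ∷ pxs) (rx ∷ rxs) =
  All.zipWith (λ (py , r) → px , py , r) (pxs , rx) ∷ allPairs-withAll pxs rxs

module _ {A : Set} {P : A → Set} (P? : (x : A) → Dec (P x)) where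

  length-filter-complement : ∀ xs → length (filter P? xs) + length (filter (¬? ∘ P?) xs) ≡ length xs
  length-filter-complement []       = refl
  length-filter-complement (x ∷ xs) with does (P? x)
  ... | true  = cong suc (length-filter-complement xs)
  ... | false = trans (+-suc _ _) (cong suc (length-filter-complement xs))

  length-filter-map : ∀ {B : Set} (f : B → A) xs → length (filter P? (map f xs)) ≡ length (filter (P? ∘ f) xs)
  length-filter-map f []       = refl
  length-filter-map f (x ∷ xs) with does (P? (f x))
  ... | true  = cong suc (length-filter-map f xs)
  ... | false = length-filter-map f xs

distinctSubvector : ∀ {A : Set} n (xs : List A) → AllPairs _≢_ xs → n ≤ length xs →
                    ∃ λ (ys : Vec A n) → VecAllPairs.AllPairs _≢_ ys × VecAll.All (_∈ xs) ys
distinctSubvector zero    xs       _                     _        = [] , [] , []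
distinctSubvector (suc n) (x ∷ xs) (x≢xs ∷ xs-distinct) (s≤s n≤) =
  let (ys , ys-distinct , ys∈xs) = distinctSubvector n xs xs-distinct n≤ in
  x ∷ ys , VecAll.map (All.lookup x≢xs) ys∈xs ∷ ys-distinct , here refl ∷ VecAll.map there ys∈xs

without : ∀ {n} → Fin n → List (Fin n) → List (Fin n)
without z = filter (λ x → ¬? (x ≟ z))

without-∉ : ∀ {n} {z : Fin n} {xs} → z ∉ xs → without z xs ≡ xs
without-∉ {xs = xs} z∉xs = filter-all (λ x → ¬? (x ≟ _)) (All.map ≢-sym (All.¬Any⇒All¬ xs z∉xs))

length-without : ∀ {n} (z : Fin n) {xs} → AllPairs _≢_ xs → length xs ≤ suc (length (without z xs))
length-without z {[]}     []                    = z≤n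
length-without z {x ∷ xs} (x≢xs ∷ xs-distinct) with x ≟ z
... | yes refl = s≤s (≤-reflexive (cong length (sym (without-∉ {z = z} {xs} (All.All¬⇒¬Any x≢xs)))))
... | no  _    = s≤s (length-without z xs-distinct)

module _ {n} (F : Fin n) (π : Permutation′ n) where

  tri-F : tri F π F ≡ F
  tri-F rewrite dec-true (F ≟ F) refl = refl

  tri-preimage : ∀ {x} → x ≢ F → x ≡ π ⟨$⟩ˡ F → tri F π x ≡ π ⟨$⟩ʳ F
  tri-preimage {x} x≢F x≡ rewrite dec-false (x ≟ F) x≢F | dec-true (x ≟ π ⟨$⟩ˡ F) x≡ = refl

  tri-other : ∀ {x} → x ≢ F → x ≢ π ⟨$⟩ˡ F → tri F π x ≡ π ⟨$⟩ʳ x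
  tri-other {x} x≢F x≢ rewrite dec-false (x ≟ F) x≢F | dec-false (x ≟ π ⟨$⟩ˡ F) x≢ = refl

transpose-matchˡ : ∀ {n} (i j : Fin n) → PC.transpose i j i ≡ j
transpose-matchˡ i j rewrite dec-true (i ≟ i) refl = refl

transpose-matchʳ : ∀ {n} (i j : Fin n) → PC.transpose i j j ≡ i
transpose-matchʳ i j with j ≟ i
... | yes j≡i = j≡i
... | no  _   rewrite dec-true (j ≟ j) refl = refl

transpose-other : ∀ {n} {i j k : Fin n} → k ≢ i → k ≢ j → PC.transpose i j k ≡ k
transpose-other {i = i} {j} {k} k≢i k≢j rewrite dec-false (k ≟ i) k≢i | dec-false (k ≟ j) k≢j = refl

⟨$⟩ʳ-injective : ∀ {n} (π : Permutation′ n) {x y} → π ⟨$⟩ʳ x ≡ π ⟨$⟩ʳ y → x ≡ y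
⟨$⟩ʳ-injective π {x} {y} eq = begin
  x                  ≡⟨ inverseˡ π ⟨
  π ⟨$⟩ˡ (π ⟨$⟩ʳ x) ≡⟨ cong (π ⟨$⟩ˡ_) eq ⟩
  π ⟨$⟩ˡ (π ⟨$⟩ʳ y) ≡⟨ inverseˡ π ⟩
  y                  ∎
  where open ≡-Reasoning

triPerm : ∀ {n} → Fin n → Permutation′ n → Permutation′ n
triPerm F π = π ∘ₚ transpose (π ⟨$⟩ʳ F) F

tri≡triPerm : ∀ {n} (F : Fin n) (π : Permutation′ n) x → tri F π x ≡ triPerm F π ⟨$⟩ʳ x
tri≡triPerm F π x = byCases (x ≟ F) (x ≟ π ⟨$⟩ˡ F)
  where
  open ≡-Reasoning
  byCases : Dec (x ≡ F) → Dec (x ≡ π ⟨$⟩ˡ F) → tri F π x ≡ triPerm F π ⟨$⟩ʳ x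
  byCases (yes refl) _        = trans (tri-F F π) (sym (transpose-matchˡ (π ⟨$⟩ʳ x) x))
  byCases (no x≢F)   (yes x≡) = trans (tri-preimage F π x≢F x≡) (sym (begin
    PC.transpose (π ⟨$⟩ʳ F) F (π ⟨$⟩ʳ x)            ≡⟨ cong (λ y → PC.transpose (π ⟨$⟩ʳ F) F (π ⟨$⟩ʳ y)) x≡ ⟩
    PC.transpose (π ⟨$⟩ʳ F) F (π ⟨$⟩ʳ (π ⟨$⟩ˡ F)) ≡⟨ cong (PC.transpose (π ⟨$⟩ʳ F) F) (inverseʳ π) ⟩
    PC.transpose (π ⟨$⟩ʳ F) F F                      ≡⟨ transpose-matchʳ (π ⟨$⟩ʳ F) F ⟩
    π ⟨$⟩ʳ F                                         ∎))
  byCases (no x≢F)   (no x≢)  = trans (tri-other F π x≢F x≢) (sym (transpose-other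
    (λ πx≡πF → x≢F (⟨$⟩ʳ-injective π πx≡πF))
    (λ πx≡F → x≢ (trans (sym (inverseˡ π)) (cong (π ⟨$⟩ˡ_) πx≡F)))))

tri-cong : ∀ {n} (F : Fin n) {π σ : Permutation′ n} → (∀ x → π ⟨$⟩ʳ x ≡ σ ⟨$⟩ʳ x) → ∀ x → tri F π x ≡ tri F σ x
tri-cong F {π} {σ} π≗σ x = begin
  tri F π x                                  ≡⟨ tri≡triPerm F π x ⟩
  PC.transpose (π ⟨$⟩ʳ F) F (π ⟨$⟩ʳ x)      ≡⟨ cong₂ (λ a b → PC.transpose a F b) (π≗σ F) (π≗σ x) ⟩
  PC.transpose (σ ⟨$⟩ʳ F) F (σ ⟨$⟩ʳ x)      ≡⟨ tri≡triPerm F σ x ⟨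
  tri F σ x                                  ∎
  where open ≡-Reasoning

module _ {n} {F : Fin n} {π σ : Permutation′ n} where

  agreement-if-F-agrees : π ⟨$⟩ʳ F ≡ σ ⟨$⟩ʳ F → ∀ {x} → x ≢ F → tri F π x ≡ tri F σ x → π ⟨$⟩ʳ x ≡ σ ⟨$⟩ʳ x
  agreement-if-F-agrees πF≡σF {x} x≢F agree = byCases (x ≟ π ⟨$⟩ˡ F) (x ≟ σ ⟨$⟩ˡ F)
    where
    byCases : Dec (x ≡ π ⟨$⟩ˡ F) → Dec (x ≡ σ ⟨$⟩ˡ F) → π ⟨$⟩ʳ x ≡ σ ⟨$⟩ʳ x
    byCases (yes x≡π⁻¹F) (yes x≡σ⁻¹F) =
      trans (cong (π ⟨$⟩ʳ_) x≡π⁻¹F) (trans (inverseʳ π) (sym (trans (cong (σ ⟨$⟩ʳ_) x≡σ⁻¹F) (inverseʳ σ))))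
    byCases (yes x≡π⁻¹F) (no x≢σ⁻¹F)  = ⊥-elim (x≢F (⟨$⟩ʳ-injective σ
      (trans (sym (tri-other F σ x≢F x≢σ⁻¹F)) (trans (sym agree) (trans (tri-preimage F π x≢F x≡π⁻¹F) πF≡σF)))))
    byCases (no x≢π⁻¹F)  (yes x≡σ⁻¹F) = ⊥-elim (x≢F (⟨$⟩ʳ-injective π
      (trans (sym (tri-other F π x≢F x≢π⁻¹F)) (trans agree (trans (tri-preimage F σ x≢F x≡σ⁻¹F) (sym πF≡σF))))))
    byCases (no x≢π⁻¹F)  (no x≢σ⁻¹F)  =
      trans (sym (tri-other F π x≢F x≢π⁻¹F)) (trans agree (tri-other F σ x≢F x≢σ⁻¹F))

  disagreeing-preimage : π ⟨$⟩ʳ F ≢ σ ⟨$⟩ʳ F → ∀ {x} → x ≢ F → x ≡ π ⟨$⟩ˡ F → tri F π x ≡ tri F σ x →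
                         x ≢ σ ⟨$⟩ˡ F × σ ⟨$⟩ʳ x ≡ π ⟨$⟩ʳ F
  disagreeing-preimage πF≢σF {x} x≢F x≡π⁻¹F agree =
    x≢σ⁻¹F , trans (sym (tri-other F σ x≢F x≢σ⁻¹F)) (trans (sym agree) (tri-preimage F π x≢F x≡π⁻¹F))
    where
    x≢σ⁻¹F : x ≢ σ ⟨$⟩ˡ F
    x≢σ⁻¹F x≡σ⁻¹F =
      πF≢σF (trans (sym (tri-preimage F π x≢F x≡π⁻¹F)) (trans agree (tri-preimage F σ x≢F x≡σ⁻¹F)))

hdOn-cong : ∀ {n} (D : List (Fin n)) {f f′ g g′ : Fin n → Fin n} → f ≗ f′ → g ≗ g′ → hdOn D f g ≡ hdOn D f′ g′
hdOn-cong D {f} {f′} {g} {g′} f≗f′ g≗g′ = cong length (filter-≐ _ _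
  ( (λ {x} fx≢gx eq → fx≢gx (trans (f≗f′ x) (trans eq (sym (g≗g′ x)))))
  , (λ {x} fx≢gx eq → fx≢gx (trans (sym (f≗f′ x)) (trans eq (g≗g′ x)))) ) D)

hdOn-++ : ∀ {n} (D E : List (Fin n)) f g → hdOn (D ++ E) f g ≡ hdOn D f g + hdOn E f g
hdOn-++ D E f g = trans (cong length (filter-++ _ D E)) (length-++ (filter _ D))

hdOn-agreeing : ∀ {n} {D : List (Fin n)} {f g} → All (λ x → f x ≡ g x) D → hdOn D f g ≡ 0
hdOn-agreeing agree = cong length (filter-none _ (All.map (λ fx≡gx fx≢gx → fx≢gx fx≡gx) agree))

remove-punchIn : ∀ {n} (ρ : Permutation′ (suc n)) {i} → ρ ⟨$⟩ʳ i ≡ i →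
                 ∀ j → ρ ⟨$⟩ʳ punchIn i j ≡ punchIn i (remove i ρ ⟨$⟩ʳ j)
remove-punchIn ρ {i} ρi≡i j = trans (punchIn-permute ρ i j) (cong (λ z → punchIn z (remove i ρ ⟨$⟩ʳ j)) ρi≡i)

hd-remove : ∀ {n} (i : Fin (suc n)) (ρ ρ′ : Permutation′ (suc n)) → ρ ⟨$⟩ʳ i ≡ i → ρ′ ⟨$⟩ʳ i ≡ i →
            hd (remove i ρ) (remove i ρ′) ≡ hdOn (map (punchIn i) (allFin n)) (ρ ⟨$⟩ʳ_) (ρ′ ⟨$⟩ʳ_)
hd-remove {n} i ρ ρ′ ρi≡i ρ′i≡i = sym (trans (length-filter-map _ (punchIn i) (allFin n))
  (cong length (filter-≐ (λ j → ¬? (ρ ⟨$⟩ʳ punchIn i j ≟ ρ′ ⟨$⟩ʳ punchIn i j))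
                         (λ j → ¬? (remove i ρ ⟨$⟩ʳ j ≟ remove i ρ′ ⟨$⟩ʳ j)) (to , from) (allFin n))))
  where
  to : ∀ {j} → ρ ⟨$⟩ʳ punchIn i j ≢ ρ′ ⟨$⟩ʳ punchIn i j → remove i ρ ⟨$⟩ʳ j ≢ remove i ρ′ ⟨$⟩ʳ j
  to {j} differ eq = differ
    (trans (remove-punchIn ρ ρi≡i j) (trans (cong (punchIn i) eq) (sym (remove-punchIn ρ′ ρ′i≡i j))))
  from : ∀ {j} → remove i ρ ⟨$⟩ʳ j ≢ remove i ρ′ ⟨$⟩ʳ j → ρ ⟨$⟩ʳ punchIn i j ≢ ρ′ ⟨$⟩ʳ punchIn i j
  from {j} differ eq = differ (punchIn-injective i _ _
    (trans (sym (remove-punchIn ρ ρi≡i j)) (trans eq (remove-punchIn ρ′ ρ′i≡i j))))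

Endo : Set
Endo = Fin 12 → Fin 12

Word : Set
Word = List (Fin 3)

act : Word → Endo
act w = evalWord w ⟨$⟩ʳ_

act-++ : ∀ w w′ → act (w ++ w′) ≗ act w′ ∘ act w
act-++ []      w′ x = refl
act-++ (i ∷ w) w′ x = act-++ w w′ (gen i ⟨$⟩ʳ x)

act-++-injectiveˡ : ∀ w w′ v → act (w ++ v) ≗ act (w′ ++ v) → act w ≗ act w′
act-++-injectiveˡ w w′ v eq x =
  ⟨$⟩ʳ-injective (evalWord v) (trans (sym (act-++ w v x)) (trans (eq x) (act-++ w′ v x)))

Distinct : Word → Word → Set
Distinct w w′ = ¬ (act w ≗ act w′)

Table : Set
Table = Vec (Fin 12) 12

genTable : Fin 3 → Table
genTable = lookup
  ( (1 ∷ 2 ∷ 3 ∷ 4 ∷ 5 ∷ 6 ∷ 7 ∷ 8 ∷ 9 ∷ 10 ∷ 0 ∷ 11 ∷ [])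
  ∷ (0 ∷ 1 ∷ 6 ∷ 9 ∷ 5 ∷ 3 ∷ 10 ∷ 2 ∷ 8 ∷ 4 ∷ 7 ∷ 11 ∷ [])
  ∷ (11 ∷ 10 ∷ 5 ∷ 7 ∷ 8 ∷ 2 ∷ 9 ∷ 3 ∷ 4 ∷ 6 ∷ 1 ∷ 0 ∷ [])
  ∷ [])

-- act, computed through genTable; it normalises quickly, so decisions are run on this form.
actₜ : Word → Endo
actₜ []      x = x
actₜ (i ∷ w) x = actₜ w (lookup (genTable i) x)

genTable-correct : ∀ i x → gen i ⟨$⟩ʳ x ≡ lookup (genTable i) x
genTable-correct = from-yes (all? λ i → all? λ x → gen i ⟨$⟩ʳ x ≟ lookup (genTable i) x)

actₜ≗act : ∀ w → actₜ w ≗ act w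
actₜ≗act []      x = refl
actₜ≗act (i ∷ w) x = trans (actₜ≗act w _) (cong (act w) (sym (genTable-correct i x)))

tableProduct : ∀ {k} → (Fin k → Table) → List (Fin k) → Endo
tableProduct S []       = id
tableProduct S (s ∷ ss) = lookup (S s) ∘ tableProduct S ss

noGens : Fin 0 → Table
noGens ()

moved : List (Fin 12) → List (Fin 12)
moved fixed = filter (_∉? fixed) (allFin 12)

-- Stabiliser chains

-- The pointwise stabiliser of fixed in M₁₂, described through base: its members are
-- determined by, and realise every injective choice of, the images of the base points,
-- and elements lists it without repetition.
record Stabiliser (fixed : List (Fin 12)) {m} (base : Vec (Fin 12) m) {k} (gens : Fin k → Table) : Set₁ where
  field
    Member         : Endo → Set
    Member-resp    : ∀ {h h′} → h ≗ h′ → Member h → Member h′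
    Member-id      : Member id
    Member-gen     : ∀ s {h} → Member h → Member (lookup (gens s) ∘ h)
    Member-fixes   : ∀ {h} → Member h → All (λ p → h p ≡ p) fixed
    Member-word    : ∀ {h} → Member h → ∃ λ w → h ≗ act w
    determined     : ∀ {h h′} → Member h → Member h′ → VecAll.All (λ p → h p ≡ h′ p) base → h ≗ h′
    transitive     : ∀ ts → VecAllPairs.AllPairs _≢_ ts → VecAll.All (_∉ fixed) ts →
                     ∃ λ h → Member h × Vec.map h base ≡ ts
    elements          : List Word
    elements-member   : All (Member ∘ act) elements
    elements-distinct : AllPairs Distinct elements
    order             : ℕ
    length-elements   : length elements ≡ order

trivialStabiliser : ∀ fixed → Stabiliser fixed [] noGens
trivialStabiliser fixed = record
  { Member            = λ h → h ≗ id
  ; Member-resp       = λ h≗h′ h≗id x → trans (sym (h≗h′ x)) (h≗id x)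
  ; Member-id         = λ _ → refl
  ; Member-gen        = λ ()
  ; Member-fixes      = λ h≗id → All.tabulate (λ {p} _ → h≗id p)
  ; Member-word       = λ h≗id → [] , h≗id
  ; determined        = λ h≗id h′≗id _ x → trans (h≗id x) (sym (h′≗id x))
  ; transitive        = λ { [] _ _ → id , (λ _ → refl) , refl }
  ; elements          = [] ∷ []
  ; elements-member   = (λ _ → refl) ∷ []
  ; elements-distinct = [] ∷ []
  ; order             = 1
  ; length-elements   = refl
  }

-- One level of a stabiliser chain: cosetWord a is a coset representative mapping b to a,
-- and each Schreier generator (coset (gens s a))⁻¹ ∘ gens s ∘ coset a is the product of
-- the next level's generators listed by schreierWord s a.
record Certificate (fixed : List (Fin 12)) (b : Fin 12) {k k′}
                   (gens : Fin k → Table) (gens′ : Fin k′ → Table)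
                   (cosetWord : Fin 12 → Word) (schreierWord : Fin k → Fin 12 → List (Fin k′)) : Set where
  field
    base-moved  : b ∉ fixed
    base-coset  : ∀ x → actₜ (cosetWord b) x ≡ x
    coset-base  : ∀ {a} → a ∉ fixed → actₜ (cosetWord a) b ≡ a
    coset-fixes : ∀ {a} → a ∉ fixed → All (λ p → actₜ (cosetWord a) p ≡ p) fixed
    schreier    : ∀ s {a} → a ∉ fixed →
                  lookup (gens s) a ∉ fixed ×
                  (∀ x → lookup (gens s) (actₜ (cosetWord a) x) ≡
                         actₜ (cosetWord (lookup (gens s) a)) (tableProduct gens′ (schreierWord s a) x))

certificate? : ∀ fixed b {k k′} (gens : Fin k → Table) (gens′ : Fin k′ → Table) cosetWord schreierWord →
               Dec (Certificate fixed b gens gens′ cosetWord schreierWord)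
certificate? fixed b gens gens′ cosetWord schreierWord =
  Dec.map′ (λ (p₁ , p₂ , p₃ , p₄ , p₅) → record
             { base-moved = p₁ ; base-coset = p₂ ; coset-base = λ {a} → p₃ {a}
             ; coset-fixes = λ {a} → p₄ {a} ; schreier = λ s {a} → p₅ s {a} })
           (λ c → let open Certificate c in
                  base-moved , base-coset , (λ {a} → coset-base {a}) , (λ {a} → coset-fixes {a})
                  , (λ s {a} → schreier s {a}))
    ( b ∉? fixed
    ×-dec all? (λ x → actₜ (cosetWord b) x ≟ x)
    ×-dec decFinSubset (_∉? fixed) (λ {a} _ → actₜ (cosetWord a) b ≟ a)
    ×-dec decFinSubset (_∉? fixed) (λ {a} _ → All.all? (λ p → actₜ (cosetWord a) p ≟ p) fixed)
    ×-dec all? λ s → decFinSubset (_∉? fixed) λ {a} _ →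
            lookup (gens s) a ∉? fixed
            ×-dec all? λ x → lookup (gens s) (actₜ (cosetWord a) x) ≟
                             actₜ (cosetWord (lookup (gens s) a)) (tableProduct gens′ (schreierWord s a) x))

module Cosets
  {fixed : List (Fin 12)} {b : Fin 12} {m : ℕ} {base : Vec (Fin 12) m}
  {k k′ : ℕ} {gens : Fin k → Table} {gens′ : Fin k′ → Table}
  {cosetWord : Fin 12 → Word} {schreierWord : Fin k → Fin 12 → List (Fin k′)}
  (cert : Certificate fixed b gens gens′ cosetWord schreierWord)
  (G′ : Stabiliser (b ∷ fixed) base gens′)
  where

  open Certificate cert public
  private module G′ = Stabiliser G′
  open ≡-Reasoning

  coset : Fin 12 → Endo
  coset a = actₜ (cosetWord a)

  coset≗act : ∀ a → coset a ≗ act (cosetWord a)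
  coset≗act a = actₜ≗act (cosetWord a)

  coset-injective : ∀ a {x y} → coset a x ≡ coset a y → x ≡ y
  coset-injective a {x} {y} eq =
    ⟨$⟩ʳ-injective (evalWord (cosetWord a)) (trans (sym (coset≗act a x)) (trans eq (coset≗act a y)))

  coset⁻¹ : Fin 12 → Endo
  coset⁻¹ a = evalWord (cosetWord a) ⟨$⟩ˡ_

  coset-coset⁻¹ : ∀ a y → coset a (coset⁻¹ a y) ≡ y
  coset-coset⁻¹ a y = trans (coset≗act a _) (inverseʳ (evalWord (cosetWord a)))

  coset⁻¹-injective : ∀ a {x y} → coset⁻¹ a x ≡ coset⁻¹ a y → x ≡ y
  coset⁻¹-injective a {x} {y} eq =
    trans (sym (coset-coset⁻¹ a x)) (trans (cong (coset a) eq) (coset-coset⁻¹ a y))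

  fixes-base : ∀ {r} → G′.Member r → r b ≡ b
  fixes-base r∈ = All.head (G′.Member-fixes r∈)

  record Member (h : Endo) : Set where
    constructor factor
    field
      point         : Fin 12
      point-moved   : point ∉ fixed
      rest          : Endo
      rest-member   : G′.Member rest
      factorisation : h ≗ coset point ∘ rest

  member-base : ∀ {h} (h∈ : Member h) → h b ≡ Member.point h∈
  member-base (factor a a∉ r r∈ h≗) =
    trans (h≗ b) (trans (cong (coset a) (fixes-base r∈)) (coset-base a∉))

  Member-resp : ∀ {h h′} → h ≗ h′ → Member h → Member h′
  Member-resp h≗h′ (factor a a∉ r r∈ h≗) = factor a a∉ r r∈ (λ x → trans (sym (h≗h′ x)) (h≗ x))

  Member-id : Member id
  Member-id = factor b base-moved id G′.Member-id (λ x → sym (base-coset x))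

  tableProduct-member : ∀ ss {r} → G′.Member r → G′.Member (tableProduct gens′ ss ∘ r)
  tableProduct-member []       r∈ = r∈
  tableProduct-member (s ∷ ss) r∈ = G′.Member-gen s (tableProduct-member ss r∈)

  Member-gen : ∀ s {h} → Member h → Member (lookup (gens s) ∘ h)
  Member-gen s (factor a a∉ r r∈ h≗) =
    factor (lookup (gens s) a) (proj₁ (schreier s a∉))
           (tableProduct gens′ (schreierWord s a) ∘ r) (tableProduct-member (schreierWord s a) r∈)
           (λ x → trans (cong (lookup (gens s)) (h≗ x)) (proj₂ (schreier s a∉) (r x)))

  Member-fixes : ∀ {h} → Member h → All (λ p → h p ≡ p) fixed
  Member-fixes (factor a a∉ r r∈ h≗) =
    All.zipWith (λ {p} (rp≡p , ap≡p) → trans (h≗ p) (trans (cong (coset a) rp≡p) ap≡p))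
                (All.tail (G′.Member-fixes r∈) , coset-fixes a∉)

  Member-word : ∀ {h} → Member h → ∃ λ w → h ≗ act w
  Member-word (factor a a∉ r r∈ h≗) =
    let (w , r≗w) = G′.Member-word r∈ in
    w ++ cosetWord a , λ x → begin
      _                          ≡⟨ h≗ x ⟩
      coset a (r x)              ≡⟨ cong (coset a) (r≗w x) ⟩
      coset a (act w x)          ≡⟨ coset≗act a _ ⟩
      act (cosetWord a) (act w x) ≡⟨ act-++ w (cosetWord a) x ⟨
      act (w ++ cosetWord a) x   ∎

  determined : ∀ {h h′} → Member h → Member h′ → VecAll.All (λ p → h p ≡ h′ p) (b ∷ base) → h ≗ h′
  determined h∈ h′∈ (hb≡h′b ∷ agree) =
    samePoint h∈ h′∈ (trans (sym (member-base h∈)) (trans hb≡h′b (member-base h′∈))) agree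
    where
    samePoint : ∀ {h h′} (h∈ : Member h) (h′∈ : Member h′) → Member.point h∈ ≡ Member.point h′∈ →
                VecAll.All (λ p → h p ≡ h′ p) base → h ≗ h′
    samePoint {h} {h′} (factor a _ r r∈ h≗) (factor .a _ r′ r′∈ h′≗) refl agree x = begin
      h x            ≡⟨ h≗ x ⟩
      coset a (r x)  ≡⟨ cong (coset a) (G′.determined r∈ r′∈ restsAgree x) ⟩
      coset a (r′ x) ≡⟨ h′≗ x ⟨
      h′ x           ∎
      where
      restsAgree : VecAll.All (λ p → r p ≡ r′ p) base
      restsAgree = VecAll.map (λ {p} hp≡h′p → coset-injective a (trans (sym (h≗ p)) (trans hp≡h′p (h′≗ p)))) agree

  transitive : ∀ ts → VecAllPairs.AllPairs _≢_ ts → VecAll.All (_∉ fixed) ts →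
               ∃ λ h → Member h × Vec.map h (b ∷ base) ≡ ts
  transitive (t ∷ ts) (t≢ts ∷ ts-distinct) (t∉ ∷ ts∉) =
    extend (G′.transitive (Vec.map (coset⁻¹ t) ts) pulled-distinct pulled-moved)
    where
    pulled-distinct : VecAllPairs.AllPairs _≢_ (Vec.map (coset⁻¹ t) ts)
    pulled-distinct = VecAllPairs.map⁺ (VecAllPairs.map (λ x≢y eq → x≢y (coset⁻¹-injective t eq)) ts-distinct)

    pull-moved : ∀ {t′} → t ≢ t′ × t′ ∉ fixed → coset⁻¹ t t′ ∉ b ∷ fixed
    pull-moved (t≢t′ , t′∉) (here eq) =
      t≢t′ (trans (sym (coset-base t∉)) (trans (cong (coset t) (sym eq)) (coset-coset⁻¹ t _)))
    pull-moved (t≢t′ , t′∉) (there p∈) =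
      t′∉ (subst (_∈ fixed) (trans (sym (All.lookup (coset-fixes t∉) p∈)) (coset-coset⁻¹ t _)) p∈)

    pulled-moved : VecAll.All (_∉ b ∷ fixed) (Vec.map (coset⁻¹ t) ts)
    pulled-moved = VecAll.map⁺ (VecAll.map pull-moved (VecAll.zip (t≢ts , ts∉)))

    extend : (∃ λ r → G′.Member r × Vec.map r base ≡ Vec.map (coset⁻¹ t) ts) →
             ∃ λ h → Member h × Vec.map h (b ∷ base) ≡ t ∷ ts
    extend (r , r∈ , r-base) =
      coset t ∘ r , factor t t∉ r r∈ (λ _ → refl) ,
      cong₂ _∷_ (trans (cong (coset t) (fixes-base r∈)) (coset-base t∉)) (begin
        Vec.map (coset t ∘ r) base                  ≡⟨ map-∘ (coset t) r base ⟩
        Vec.map (coset t) (Vec.map r base)          ≡⟨ cong (Vec.map (coset t)) r-base ⟩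
        Vec.map (coset t) (Vec.map (coset⁻¹ t) ts) ≡⟨ map-∘ (coset t) (coset⁻¹ t) ts ⟨
        Vec.map (coset t ∘ coset⁻¹ t) ts           ≡⟨ map-cong (coset-coset⁻¹ t) ts ⟩
        Vec.map id ts                               ≡⟨ map-id ts ⟩
        ts                                          ∎)

  cosetBlock : (Fin 12 → List Word) → Fin 12 → List Word
  cosetBlock ws a = map (_++ cosetWord a) (ws a)

  cosetWords : List (Fin 12) → (Fin 12 → List Word) → List Word
  cosetWords as ws = concatMap (cosetBlock ws) as

  cosetWord-member : ∀ {a} w → a ∉ fixed → G′.Member (act w) → Member (act (w ++ cosetWord a))
  cosetWord-member {a} w a∉ w∈ =
    factor a a∉ (act w) w∈ (λ x → trans (act-++ w (cosetWord a) x) (sym (coset≗act a _)))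

  cosetWords-All : ∀ {P : Word → Set} {as} ws → All (λ a → All (λ w → P (w ++ cosetWord a)) (ws a)) as →
                   All P (cosetWords as ws)
  cosetWords-All {as = as} ws P-ws =
    All.concat⁺ {xss = map (cosetBlock ws) as} (All.map⁺ (All.map (λ {a} → All.map⁺ {xs = ws a}) P-ws))

  cosetWords-member : ∀ {as} ws → All (_∉ fixed) as → (∀ a → All (G′.Member ∘ act) (ws a)) →
                      All (Member ∘ act) (cosetWords as ws)
  cosetWords-member {as} ws as∉ ws∈ =
    All.concat⁺ {xss = map (cosetBlock ws) as}
      (All.map⁺ (All.map (λ {a} a∉ → All.map⁺ {xs = ws a} (All.map (λ {w} → cosetWord-member w a∉) (ws∈ a))) as∉))

  cosetWords-distinct : ∀ {as} ws → AllPairs _≢_ as → All (_∉ fixed) as →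
                        (∀ a → All (G′.Member ∘ act) (ws a)) → (∀ a → AllPairs Distinct (ws a)) →
                        AllPairs Distinct (cosetWords as ws)
  cosetWords-distinct {as} ws as-distinct as∉ ws∈ ws-distinct =
    AllPairs.concat⁺ {xss = map (cosetBlock ws) as} (All.map⁺ (All.tabulate (λ {a} _ → within a)))
                     (AllPairs.map⁺ (AllPairs.map between (allPairs-withAll as∉ as-distinct)))
    where
    within : ∀ a → AllPairs Distinct (cosetBlock ws a)
    within a = AllPairs.map⁺ (AllPairs.map (λ {w} {w′} w≠w′ eq → w≠w′ (act-++-injectiveˡ w w′ _ eq))
                                           (ws-distinct a))

    separated : ∀ {a a′} w w′ → a ∉ fixed → a′ ∉ fixed → a ≢ a′ → G′.Member (act w) → G′.Member (act w′) →
                Distinct (w ++ cosetWord a) (w′ ++ cosetWord a′)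
    separated {a} {a′} w w′ a∉ a′∉ a≢a′ w∈ w′∈ eq = a≢a′ (begin
      a                          ≡⟨ member-base (cosetWord-member w a∉ w∈) ⟨
      act (w ++ cosetWord a) b   ≡⟨ eq b ⟩
      act (w′ ++ cosetWord a′) b ≡⟨ member-base (cosetWord-member w′ a′∉ w′∈) ⟩
      a′                         ∎)

    between : ∀ {a a′} → a ∉ fixed × a′ ∉ fixed × a ≢ a′ →
              All (λ v → All (Distinct v) (cosetBlock ws a′)) (cosetBlock ws a)
    between {a} {a′} (a∉ , a′∉ , a≢a′) =
      All.map⁺ {xs = ws a} (All.map (λ {w} w∈ → All.map⁺ {xs = ws a′}
        (All.map (λ {w′} → separated w w′ a∉ a′∉ a≢a′ w∈) (ws∈ a′))) (ws∈ a))

  length-cosetWords : ∀ as ws {n} → (∀ a → length (ws a) ≡ n) → length (cosetWords as ws) ≡ length as * n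
  length-cosetWords []       ws eq = refl
  length-cosetWords (a ∷ as) ws {n} eq = begin
    length (cosetBlock ws a ++ cosetWords as ws)          ≡⟨ length-++ (cosetBlock ws a) ⟩
    length (cosetBlock ws a) + length (cosetWords as ws)  ≡⟨ cong₂ _+_ (trans (length-map _ (ws a)) (eq a))
                                                                         (length-cosetWords as ws eq) ⟩
    n + length as * n                                     ∎

  stabiliser : Stabiliser fixed (b ∷ base) gens
  stabiliser = record
    { Member            = Member
    ; Member-resp       = Member-resp
    ; Member-id         = Member-id
    ; Member-gen        = Member-gen
    ; Member-fixes      = Member-fixes
    ; Member-word       = Member-word
    ; determined        = determined
    ; transitive        = transitive
    ; elements          = cosetWords (moved fixed) (λ _ → G′.elements)
    ; elements-member   = cosetWords-member _ moved-∉ (λ _ → G′.elements-member)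
    ; elements-distinct = cosetWords-distinct _ moved-distinct moved-∉ (λ _ → G′.elements-member)
                                              (λ _ → G′.elements-distinct)
    ; order             = length (moved fixed) * G′.order
    ; length-elements   = length-cosetWords (moved fixed) _ (λ _ → G′.length-elements)
    }
    where
    moved-∉ : All (_∉ fixed) (moved fixed)
    moved-∉ = All.all-filter (_∉? fixed) (allFin 12)
    moved-distinct : AllPairs _≢_ (moved fixed)
    moved-distinct = Unique.filter⁺ (_∉? fixed) (Unique.allFin⁺ 12)

-- A stabiliser chain of M₁₂ for the base 11, 10, 9, 8, 7; level i concerns the pointwise
-- stabiliser of the first i − 1 base points.

strongGens₂ : Fin 2 → Table
strongGens₂ = lookup
  ( (5 ∷ 9 ∷ 10 ∷ 4 ∷ 7 ∷ 3 ∷ 1 ∷ 8 ∷ 0 ∷ 6 ∷ 2 ∷ 11 ∷ [])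
  ∷ (10 ∷ 4 ∷ 3 ∷ 0 ∷ 5 ∷ 8 ∷ 6 ∷ 7 ∷ 1 ∷ 9 ∷ 2 ∷ 11 ∷ [])
  ∷ [])

strongGens₃ : Fin 2 → Table
strongGens₃ = lookup
  ( (4 ∷ 5 ∷ 3 ∷ 2 ∷ 6 ∷ 9 ∷ 8 ∷ 1 ∷ 7 ∷ 0 ∷ 10 ∷ 11 ∷ [])
  ∷ (1 ∷ 8 ∷ 2 ∷ 6 ∷ 7 ∷ 3 ∷ 5 ∷ 9 ∷ 0 ∷ 4 ∷ 10 ∷ 11 ∷ [])
  ∷ [])

strongGens₄ : Fin 2 → Table
strongGens₄ = lookup
  ( (0 ∷ 2 ∷ 7 ∷ 6 ∷ 8 ∷ 1 ∷ 4 ∷ 5 ∷ 3 ∷ 9 ∷ 10 ∷ 11 ∷ [])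
  ∷ (5 ∷ 3 ∷ 7 ∷ 2 ∷ 0 ∷ 8 ∷ 6 ∷ 1 ∷ 4 ∷ 9 ∷ 10 ∷ 11 ∷ [])
  ∷ [])

strongGens₅ : Fin 2 → Table
strongGens₅ = lookup
  ( (1 ∷ 6 ∷ 5 ∷ 7 ∷ 0 ∷ 3 ∷ 4 ∷ 2 ∷ 8 ∷ 9 ∷ 10 ∷ 11 ∷ [])
  ∷ (7 ∷ 3 ∷ 1 ∷ 4 ∷ 2 ∷ 0 ∷ 5 ∷ 6 ∷ 8 ∷ 9 ∷ 10 ∷ 11 ∷ [])
  ∷ [])

cosetWord₁ : Fin 12 → Word
cosetWord₁ = lookup
  ( (2 ∷ [])
  ∷ (2 ∷ 0 ∷ [])
  ∷ (2 ∷ 0 ∷ 0 ∷ [])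
  ∷ (2 ∷ 0 ∷ 0 ∷ 0 ∷ [])
  ∷ (2 ∷ 0 ∷ 0 ∷ 0 ∷ 0 ∷ [])
  ∷ (2 ∷ 0 ∷ 0 ∷ 2 ∷ [])
  ∷ (2 ∷ 0 ∷ 0 ∷ 1 ∷ [])
  ∷ (2 ∷ 0 ∷ 2 ∷ 1 ∷ [])
  ∷ (2 ∷ 0 ∷ 2 ∷ 1 ∷ 0 ∷ [])
  ∷ (2 ∷ 0 ∷ 0 ∷ 0 ∷ 1 ∷ [])
  ∷ (2 ∷ 0 ∷ 2 ∷ [])
  ∷ []
  ∷ [])

cosetWord₂ : Fin 12 → Word
cosetWord₂ = lookup
  ( (0 ∷ [])
  ∷ (0 ∷ 0 ∷ [])
  ∷ (1 ∷ 1 ∷ [])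
  ∷ (1 ∷ 1 ∷ 0 ∷ [])
  ∷ (1 ∷ 0 ∷ 0 ∷ 1 ∷ [])
  ∷ (1 ∷ 0 ∷ 0 ∷ 1 ∷ 0 ∷ [])
  ∷ (1 ∷ 1 ∷ 1 ∷ [])
  ∷ (1 ∷ [])
  ∷ (1 ∷ 0 ∷ [])
  ∷ (1 ∷ 0 ∷ 0 ∷ [])
  ∷ []
  ∷ []
  ∷ [])

cosetWord₃ : Fin 12 → Word
cosetWord₃ = lookup
  ( (1 ∷ 1 ∷ 0 ∷ 1 ∷ 0 ∷ [])
  ∷ (2 ∷ 1 ∷ 2 ∷ [])
  ∷ (0 ∷ 1 ∷ 1 ∷ 0 ∷ 1 ∷ 0 ∷ 1 ∷ 1 ∷ [])
  ∷ (2 ∷ 1 ∷ 1 ∷ 2 ∷ [])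
  ∷ (1 ∷ 1 ∷ 0 ∷ 0 ∷ 0 ∷ 0 ∷ 1 ∷ [])
  ∷ (1 ∷ 0 ∷ 1 ∷ 0 ∷ 0 ∷ [])
  ∷ (0 ∷ 1 ∷ 2 ∷ 0 ∷ 2 ∷ 0 ∷ 2 ∷ [])
  ∷ (1 ∷ 0 ∷ 0 ∷ 0 ∷ [])
  ∷ (0 ∷ 1 ∷ 0 ∷ 0 ∷ 0 ∷ 1 ∷ 0 ∷ [])
  ∷ []
  ∷ []
  ∷ []
  ∷ [])

cosetWord₄ : Fin 12 → Word
cosetWord₄ = lookup
  ( (0 ∷ 2 ∷ 1 ∷ 0 ∷ 2 ∷ 0 ∷ 2 ∷ [])
  ∷ (1 ∷ 1 ∷ 0 ∷ 0 ∷ 0 ∷ 1 ∷ 1 ∷ 0 ∷ [])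
  ∷ (1 ∷ 2 ∷ 0 ∷ 2 ∷ 0 ∷ 2 ∷ 1 ∷ [])
  ∷ (1 ∷ 1 ∷ 1 ∷ 0 ∷ 1 ∷ 1 ∷ 1 ∷ [])
  ∷ (0 ∷ 2 ∷ 1 ∷ 1 ∷ 1 ∷ 0 ∷ 2 ∷ 0 ∷ 2 ∷ [])
  ∷ (1 ∷ 1 ∷ 0 ∷ 1 ∷ 1 ∷ 1 ∷ 0 ∷ 1 ∷ [])
  ∷ (0 ∷ 0 ∷ 2 ∷ 1 ∷ 2 ∷ 0 ∷ 0 ∷ 0 ∷ 1 ∷ [])
  ∷ (0 ∷ 1 ∷ 1 ∷ 1 ∷ 2 ∷ 0 ∷ 2 ∷ 0 ∷ 1 ∷ 2 ∷ [])
  ∷ []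
  ∷ []
  ∷ []
  ∷ []
  ∷ [])

cosetWord₅ : Fin 12 → Word
cosetWord₅ = lookup
  ( (1 ∷ 0 ∷ 1 ∷ 0 ∷ 0 ∷ 2 ∷ 1 ∷ 2 ∷ [])
  ∷ (0 ∷ 2 ∷ 1 ∷ 1 ∷ 1 ∷ 0 ∷ 1 ∷ 1 ∷ 2 ∷ 0 ∷ 1 ∷ 2 ∷ [])
  ∷ (0 ∷ 0 ∷ 2 ∷ 0 ∷ 0 ∷ 2 ∷ 0 ∷ 1 ∷ 0 ∷ 1 ∷ 2 ∷ [])
  ∷ (1 ∷ 0 ∷ 1 ∷ 1 ∷ 1 ∷ 0 ∷ 0 ∷ 1 ∷ 1 ∷ 0 ∷ 1 ∷ 0 ∷ [])
  ∷ (1 ∷ 1 ∷ 0 ∷ 0 ∷ 1 ∷ 0 ∷ 1 ∷ [])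
  ∷ (1 ∷ 0 ∷ 2 ∷ 1 ∷ 1 ∷ 1 ∷ 0 ∷ 0 ∷ 1 ∷ 1 ∷ 0 ∷ 2 ∷ [])
  ∷ (2 ∷ 0 ∷ 1 ∷ 0 ∷ 0 ∷ 2 ∷ 1 ∷ 0 ∷ 1 ∷ 0 ∷ 0 ∷ 2 ∷ [])
  ∷ []
  ∷ []
  ∷ []
  ∷ []
  ∷ []
  ∷ [])

schreierWord₁ : Fin 3 → Fin 12 → List (Fin 2)
schreierWord₁ = lookup ∘ lookup
  ( ( []
    ∷ []
    ∷ []
    ∷ []
    ∷ (1 ∷ 1 ∷ 0 ∷ 1 ∷ 0 ∷ 0 ∷ 1 ∷ 0 ∷ 1 ∷ 0 ∷ 1 ∷ 1 ∷ 0 ∷ [])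
    ∷ (1 ∷ 1 ∷ 0 ∷ 1 ∷ 0 ∷ 0 ∷ 0 ∷ 1 ∷ 0 ∷ [])
    ∷ (0 ∷ 0 ∷ 1 ∷ 0 ∷ 1 ∷ 0 ∷ 1 ∷ 0 ∷ 0 ∷ 1 ∷ 0 ∷ 0 ∷ 1 ∷ 1 ∷ [])
    ∷ []
    ∷ (1 ∷ 0 ∷ 1 ∷ 1 ∷ 0 ∷ 0 ∷ 1 ∷ 0 ∷ 0 ∷ 1 ∷ 0 ∷ 1 ∷ 0 ∷ [])
    ∷ (1 ∷ 1 ∷ 0 ∷ 1 ∷ 1 ∷ 0 ∷ 1 ∷ 1 ∷ 0 ∷ 0 ∷ 0 ∷ 1 ∷ 0 ∷ [])
    ∷ (0 ∷ 1 ∷ 0 ∷ 1 ∷ 0 ∷ 0 ∷ 0 ∷ 0 ∷ 1 ∷ 1 ∷ 1 ∷ 0 ∷ 1 ∷ [])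
    ∷ (1 ∷ 1 ∷ 0 ∷ 1 ∷ 0 ∷ 0 ∷ 1 ∷ 1 ∷ 0 ∷ 0 ∷ 1 ∷ 1 ∷ [])
    ∷ [])
  ∷ ( (0 ∷ 1 ∷ 0 ∷ 1 ∷ 1 ∷ 1 ∷ 0 ∷ 0 ∷ 1 ∷ 1 ∷ 1 ∷ 0 ∷ 1 ∷ [])
    ∷ (0 ∷ 0 ∷ 0 ∷ 1 ∷ 1 ∷ 0 ∷ 0 ∷ 1 ∷ 1 ∷ 1 ∷ 0 ∷ 1 ∷ 0 ∷ 0 ∷ [])
    ∷ []
    ∷ []
    ∷ (0 ∷ 1 ∷ 1 ∷ 1 ∷ 0 ∷ 1 ∷ 1 ∷ 0 ∷ 1 ∷ 0 ∷ 1 ∷ 0 ∷ 0 ∷ 0 ∷ [])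
    ∷ (1 ∷ 1 ∷ 0 ∷ 1 ∷ 0 ∷ 0 ∷ 0 ∷ 1 ∷ 0 ∷ 1 ∷ 1 ∷ 1 ∷ [])
    ∷ (1 ∷ 1 ∷ 1 ∷ 0 ∷ 1 ∷ 1 ∷ 0 ∷ 0 ∷ 1 ∷ 0 ∷ 1 ∷ 0 ∷ [])
    ∷ (0 ∷ 0 ∷ 1 ∷ 0 ∷ 1 ∷ 0 ∷ 1 ∷ 1 ∷ 0 ∷ 1 ∷ 0 ∷ 0 ∷ 0 ∷ 0 ∷ [])
    ∷ (0 ∷ 0 ∷ 1 ∷ 0 ∷ 1 ∷ 1 ∷ 0 ∷ 0 ∷ 0 ∷ 0 ∷ 1 ∷ 0 ∷ 0 ∷ 0 ∷ [])
    ∷ (1 ∷ 0 ∷ 0 ∷ 1 ∷ 1 ∷ 0 ∷ 0 ∷ 0 ∷ 1 ∷ 1 ∷ 0 ∷ 0 ∷ [])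
    ∷ []
    ∷ (1 ∷ 0 ∷ 0 ∷ 1 ∷ 0 ∷ 0 ∷ 0 ∷ 0 ∷ 0 ∷ 1 ∷ 1 ∷ 1 ∷ 0 ∷ [])
    ∷ [])
  ∷ ( []
    ∷ []
    ∷ []
    ∷ (0 ∷ 0 ∷ 0 ∷ 0 ∷ 1 ∷ 1 ∷ 1 ∷ 0 ∷ 1 ∷ 0 ∷ 1 ∷ 0 ∷ 0 ∷ [])
    ∷ (0 ∷ 0 ∷ 1 ∷ 0 ∷ 1 ∷ 0 ∷ 1 ∷ 1 ∷ 0 ∷ 0 ∷ 0 ∷ 1 ∷ 0 ∷ [])
    ∷ []
    ∷ (1 ∷ 0 ∷ 1 ∷ 0 ∷ 1 ∷ 0 ∷ 0 ∷ 0 ∷ 1 ∷ 1 ∷ 0 ∷ 1 ∷ 1 ∷ 0 ∷ [])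
    ∷ (0 ∷ 0 ∷ 0 ∷ 0 ∷ 0 ∷ 1 ∷ 0 ∷ 1 ∷ 0 ∷ 1 ∷ 1 ∷ 0 ∷ 0 ∷ [])
    ∷ (1 ∷ 0 ∷ 1 ∷ 1 ∷ 1 ∷ 0 ∷ 1 ∷ 0 ∷ 0 ∷ 0 ∷ 1 ∷ [])
    ∷ (1 ∷ 0 ∷ 0 ∷ 1 ∷ 0 ∷ 1 ∷ 0 ∷ 0 ∷ 0 ∷ 0 ∷ 0 ∷ 1 ∷ 0 ∷ [])
    ∷ []
    ∷ []
    ∷ [])
  ∷ [])

schreierWord₂ : Fin 2 → Fin 12 → List (Fin 2)
schreierWord₂ = lookup ∘ lookup
  ( ( (0 ∷ 1 ∷ 1 ∷ 0 ∷ 1 ∷ 0 ∷ 1 ∷ 0 ∷ 0 ∷ [])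
    ∷ (0 ∷ 0 ∷ 1 ∷ 0 ∷ 0 ∷ 1 ∷ 0 ∷ 0 ∷ 0 ∷ 1 ∷ [])
    ∷ (0 ∷ 1 ∷ 0 ∷ 1 ∷ 0 ∷ 0 ∷ 1 ∷ 1 ∷ 0 ∷ 0 ∷ 0 ∷ 1 ∷ 1 ∷ [])
    ∷ (0 ∷ 1 ∷ 0 ∷ 0 ∷ 0 ∷ 1 ∷ 0 ∷ 1 ∷ 0 ∷ 0 ∷ 1 ∷ [])
    ∷ (0 ∷ 1 ∷ 0 ∷ 0 ∷ 1 ∷ 0 ∷ 1 ∷ 1 ∷ [])
    ∷ (0 ∷ 0 ∷ 0 ∷ 1 ∷ 0 ∷ 1 ∷ 0 ∷ 1 ∷ 0 ∷ [])
    ∷ (1 ∷ 0 ∷ 1 ∷ 0 ∷ 0 ∷ 1 ∷ 0 ∷ 0 ∷ [])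
    ∷ (0 ∷ 1 ∷ 0 ∷ 1 ∷ 0 ∷ 0 ∷ 0 ∷ 1 ∷ 0 ∷ [])
    ∷ (1 ∷ 0 ∷ 0 ∷ 0 ∷ 1 ∷ 1 ∷ 0 ∷ 1 ∷ [])
    ∷ (0 ∷ 1 ∷ 0 ∷ 0 ∷ 1 ∷ 0 ∷ 0 ∷ 0 ∷ 0 ∷ 0 ∷ [])
    ∷ (1 ∷ 0 ∷ 1 ∷ 0 ∷ 0 ∷ 1 ∷ 1 ∷ 0 ∷ 1 ∷ 1 ∷ 0 ∷ [])
    ∷ []
    ∷ [])
  ∷ ( (1 ∷ 0 ∷ 1 ∷ 0 ∷ 0 ∷ 0 ∷ 0 ∷ 0 ∷ 1 ∷ [])
    ∷ (0 ∷ 0 ∷ 1 ∷ 0 ∷ [])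
    ∷ (0 ∷ 0 ∷ 0 ∷ 1 ∷ 0 ∷ 0 ∷ 0 ∷ 0 ∷ 0 ∷ [])
    ∷ (1 ∷ 0 ∷ 0 ∷ 1 ∷ 0 ∷ 1 ∷ 1 ∷ 0 ∷ 0 ∷ 1 ∷ 1 ∷ [])
    ∷ (1 ∷ 0 ∷ 0 ∷ 0 ∷ 0 ∷ 0 ∷ 0 ∷ 1 ∷ 0 ∷ 1 ∷ 0 ∷ [])
    ∷ (1 ∷ 1 ∷ 0 ∷ 1 ∷ 0 ∷ 0 ∷ 1 ∷ 0 ∷ [])
    ∷ (0 ∷ 1 ∷ 0 ∷ 1 ∷ 0 ∷ 0 ∷ 1 ∷ 1 ∷ 0 ∷ [])
    ∷ (0 ∷ 0 ∷ [])
    ∷ (0 ∷ 1 ∷ 1 ∷ 0 ∷ 1 ∷ 0 ∷ 1 ∷ 0 ∷ 0 ∷ [])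
    ∷ (1 ∷ 0 ∷ 0 ∷ 0 ∷ 1 ∷ [])
    ∷ (0 ∷ 1 ∷ 0 ∷ 1 ∷ 0 ∷ 0 ∷ 0 ∷ 1 ∷ [])
    ∷ []
    ∷ [])
  ∷ [])

schreierWord₃ : Fin 2 → Fin 12 → List (Fin 2)
schreierWord₃ = lookup ∘ lookup
  ( ( (0 ∷ 0 ∷ 1 ∷ 1 ∷ 1 ∷ 0 ∷ 1 ∷ [])
    ∷ (1 ∷ 1 ∷ 0 ∷ 1 ∷ [])
    ∷ (1 ∷ 0 ∷ 0 ∷ 1 ∷ 0 ∷ 0 ∷ [])
    ∷ (0 ∷ 0 ∷ 1 ∷ 1 ∷ 0 ∷ [])
    ∷ (0 ∷ 1 ∷ 1 ∷ 1 ∷ 0 ∷ 1 ∷ [])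
    ∷ (0 ∷ 0 ∷ 1 ∷ 0 ∷ 0 ∷ [])
    ∷ (0 ∷ 1 ∷ 0 ∷ 1 ∷ 0 ∷ [])
    ∷ (0 ∷ 1 ∷ 1 ∷ 1 ∷ 0 ∷ 0 ∷ [])
    ∷ (1 ∷ 1 ∷ 1 ∷ 0 ∷ 0 ∷ [])
    ∷ (1 ∷ 0 ∷ 1 ∷ 0 ∷ [])
    ∷ []
    ∷ []
    ∷ [])
  ∷ ( (0 ∷ 1 ∷ 1 ∷ 1 ∷ [])
    ∷ (1 ∷ 0 ∷ 0 ∷ 1 ∷ [])
    ∷ (0 ∷ 1 ∷ 1 ∷ 1 ∷ 0 ∷ 1 ∷ [])
    ∷ (1 ∷ 0 ∷ 0 ∷ 1 ∷ 1 ∷ [])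
    ∷ (0 ∷ 0 ∷ 0 ∷ [])
    ∷ (0 ∷ 0 ∷ 0 ∷ 1 ∷ 0 ∷ 0 ∷ 1 ∷ [])
    ∷ (0 ∷ 1 ∷ 0 ∷ 1 ∷ 0 ∷ 1 ∷ [])
    ∷ (0 ∷ 0 ∷ 1 ∷ 1 ∷ 0 ∷ [])
    ∷ (0 ∷ 1 ∷ 1 ∷ 1 ∷ 0 ∷ 0 ∷ [])
    ∷ (1 ∷ 1 ∷ 0 ∷ 0 ∷ [])
    ∷ []
    ∷ []
    ∷ [])
  ∷ [])

schreierWord₄ : Fin 2 → Fin 12 → List (Fin 2)
schreierWord₄ = lookup ∘ lookup
  ( ( (0 ∷ 0 ∷ 1 ∷ [])
    ∷ (1 ∷ [])
    ∷ (0 ∷ 0 ∷ 0 ∷ [])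
    ∷ (0 ∷ 1 ∷ [])
    ∷ (1 ∷ 0 ∷ [])
    ∷ (0 ∷ [])
    ∷ (1 ∷ [])
    ∷ (1 ∷ [])
    ∷ (1 ∷ [])
    ∷ []
    ∷ []
    ∷ []
    ∷ [])
  ∷ ( (0 ∷ 0 ∷ 0 ∷ [])
    ∷ (0 ∷ 1 ∷ [])
    ∷ (0 ∷ 0 ∷ [])
    ∷ (0 ∷ 1 ∷ [])
    ∷ (0 ∷ 1 ∷ [])
    ∷ (0 ∷ 0 ∷ [])
    ∷ (1 ∷ 0 ∷ [])
    ∷ []
    ∷ (1 ∷ [])
    ∷ []
    ∷ []
    ∷ []
    ∷ [])
  ∷ [])

certificate₅ : Certificate (8 ∷ 9 ∷ 10 ∷ 11 ∷ []) 7 strongGens₅ noGens cosetWord₅ (λ _ _ → [])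
certificate₅ = from-yes (certificate? (8 ∷ 9 ∷ 10 ∷ 11 ∷ []) 7 strongGens₅ noGens cosetWord₅ (λ _ _ → []))

certificate₄ : Certificate (9 ∷ 10 ∷ 11 ∷ []) 8 strongGens₄ strongGens₅ cosetWord₄ schreierWord₄
certificate₄ = from-yes (certificate? (9 ∷ 10 ∷ 11 ∷ []) 8 strongGens₄ strongGens₅ cosetWord₄ schreierWord₄)

certificate₃ : Certificate (10 ∷ 11 ∷ []) 9 strongGens₃ strongGens₄ cosetWord₃ schreierWord₃
certificate₃ = from-yes (certificate? (10 ∷ 11 ∷ []) 9 strongGens₃ strongGens₄ cosetWord₃ schreierWord₃)

certificate₂ : Certificate (11 ∷ []) 10 strongGens₂ strongGens₃ cosetWord₂ schreierWord₂
certificate₂ = from-yes (certificate? (11 ∷ []) 10 strongGens₂ strongGens₃ cosetWord₂ schreierWord₂)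

certificate₁ : Certificate [] 11 genTable strongGens₂ cosetWord₁ schreierWord₁
certificate₁ = from-yes (certificate? [] 11 genTable strongGens₂ cosetWord₁ schreierWord₁)

G₆ : Stabiliser (7 ∷ 8 ∷ 9 ∷ 10 ∷ 11 ∷ []) [] noGens
G₆ = trivialStabiliser _

module Cosets₅ = Cosets certificate₅ G₆

G₅ : Stabiliser (8 ∷ 9 ∷ 10 ∷ 11 ∷ []) (7 ∷ []) strongGens₅
G₅ = Cosets₅.stabiliser

module Cosets₄ = Cosets certificate₄ G₅

G₄ : Stabiliser (9 ∷ 10 ∷ 11 ∷ []) (8 ∷ 7 ∷ []) strongGens₄
G₄ = Cosets₄.stabiliser

module Cosets₃ = Cosets certificate₃ G₄

G₃ : Stabiliser (10 ∷ 11 ∷ []) (9 ∷ 8 ∷ 7 ∷ []) strongGens₃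
G₃ = Cosets₃.stabiliser

module Cosets₂ = Cosets certificate₂ G₃

G₂ : Stabiliser (11 ∷ []) (10 ∷ 9 ∷ 8 ∷ 7 ∷ []) strongGens₂
G₂ = Cosets₂.stabiliser

module Cosets₁ = Cosets certificate₁ G₂

G₁ : Stabiliser [] (11 ∷ 10 ∷ 9 ∷ 8 ∷ 7 ∷ []) genTable
G₁ = Cosets₁.stabiliser

open Stabiliser G₁
  using (Member; Member-resp; Member-id; Member-gen; Member-word; determined; transitive;
         elements; elements-distinct; length-elements)

-- Sharp 5-transitivity of M₁₂

act-member′ : ∀ w {h} → Member h → Member (act w ∘ h)
act-member′ []      h∈ = h∈
act-member′ (i ∷ w) h∈ =
  act-member′ w (Member-resp (λ x → sym (genTable-correct i _)) (Member-gen i h∈))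

act-member : ∀ w → Member (act w)
act-member w = act-member′ w Member-id

InM12⇒Member : ∀ {π} → InM12 π → Member (π ⟨$⟩ʳ_)
InM12⇒Member (w , π≈w) = Member-resp (λ x → sym (π≈w x)) (act-member w)

Member-∘ : ∀ {h h′} → Member h → Member h′ → Member (h ∘ h′)
Member-∘ {h} {h′} h∈ h′∈ =
  let (w , h≗w) = Member-word h∈ in Member-resp (λ x → sym (h≗w (h′ x))) (act-member′ w h′∈)

Member-injective : ∀ {h} → Member h → ∀ {x y} → h x ≡ h y → x ≡ y
Member-injective h∈ {x} {y} eq =
  let (w , h≗w) = Member-word h∈ in ⟨$⟩ʳ-injective (evalWord w) (trans (sym (h≗w x)) (trans eq (h≗w y)))

Member-surjective : ∀ {h} → Member h → ∀ y → ∃ λ x → h x ≡ y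
Member-surjective h∈ y =
  let (w , h≗w) = Member-word h∈ in evalWord w ⟨$⟩ˡ y , trans (h≗w _) (inverseʳ (evalWord w))

agreement-on-five⇒≗ : ∀ {π σ} → Member π → Member σ → (A : List (Fin 12)) → AllPairs _≢_ A → 5 ≤ length A →
                       All (λ x → π x ≡ σ x) A → π ≗ σ
agreement-on-five⇒≗ {π} {σ} π∈ σ∈ A A-distinct 5≤A agree y =
  let (ps , ps-distinct , ps∈A) = distinctSubvector 5 A A-distinct 5≤A
      (k , k∈ , k-base) = transitive ps ps-distinct (VecAll.universal (λ _ ()) ps)
      (x , kx≡y) = Member-surjective k∈ y
      πk≗σk = determined (Member-∘ π∈ k∈) (Member-∘ σ∈ k∈)
                (VecAll.map⁻ (subst (VecAll.All (λ p → π p ≡ σ p)) (sym k-base) (VecAll.map (All.lookup agree) ps∈A)))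
  in trans (cong π (sym kx≡y)) (trans (πk≗σk x) (cong σ kx≡y))

-- The pointwise stabiliser of 8, 9, 10, 11 has order 8, so none of its elements has order 3.
stabiliser₅-no-order-three : ∀ {c} → c ∉ 8 ∷ 9 ∷ 10 ∷ 11 ∷ [] →
                             Cosets₅.coset c (Cosets₅.coset c (Cosets₅.coset c 7)) ≡ 7 → c ≡ 7
stabiliser₅-no-order-three {c} = from-yes (decFinSubset (_∉? (8 ∷ 9 ∷ 10 ∷ 11 ∷ [])) λ {c} _ →
  (Cosets₅.coset c (Cosets₅.coset c (Cosets₅.coset c 7)) ≟ 7) →-dec (c ≟ 7)) {c}

-- Here π = σ ∘ coset₅ c, and the 3-cycle makes the cube of coset₅ c fix 7.
no-3-cycle-at-base : ∀ {π σ} → Member π → Member σ → VecAll.All (λ q → π q ≡ σ q) (11 ∷ 10 ∷ 9 ∷ 8 ∷ []) →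
                     ∀ {c c′} → c ∉ 8 ∷ 9 ∷ 10 ∷ 11 ∷ [] → π 7 ≡ σ c → π c ≡ σ c′ → π c′ ≡ σ 7 → c ≡ 7
no-3-cycle-at-base {π} {σ} π∈ σ∈ (a₁₁ ∷ a₁₀ ∷ a₉ ∷ a₈ ∷ []) {c} {c′} c∉ π7≡σc πc≡σc′ πc′≡σ7 =
  stabiliser₅-no-order-three c∉ (trans (cong (e ∘ e) e7≡c) eec≡7)
  where
  e : Endo
  e = Cosets₅.coset c
  e7≡c : e 7 ≡ c
  e7≡c = Cosets₅.coset-base c∉
  e∈ : Member e
  e∈ = Member-resp (λ x → sym (Cosets₅.coset≗act c x)) (act-member (cosetWord₅ c))
  shifted : ∀ {q} → q ∈ 8 ∷ 9 ∷ 10 ∷ 11 ∷ [] → π q ≡ σ q → π q ≡ σ (e q)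
  shifted q∈ πq≡σq = trans πq≡σq (cong σ (sym (All.lookup (Cosets₅.coset-fixes c∉) q∈)))
  π≗σe : π ≗ σ ∘ e
  π≗σe = determined π∈ (Member-∘ σ∈ e∈)
    ( shifted (there (there (there (here refl)))) a₁₁ ∷ shifted (there (there (here refl))) a₁₀
    ∷ shifted (there (here refl)) a₉ ∷ shifted (here refl) a₈ ∷ trans π7≡σc (cong σ (sym e7≡c)) ∷ [])
  ec≡c′ : e c ≡ c′
  ec≡c′ = Member-injective σ∈ (trans (sym (π≗σe c)) πc≡σc′)
  eec≡7 : e (e c) ≡ 7
  eec≡7 = Member-injective σ∈ (trans (sym (π≗σe (e c))) (trans (cong π ec≡c′) πc′≡σ7))

-- Conjugating by an element that maps the base to p₁, p₂, p₃, p₄, u reduces this to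
-- no-3-cycle-at-base.
no-3-cycle-fixing-four : ∀ {π σ} → Member π → Member σ → (A : List (Fin 12)) → AllPairs _≢_ A → 4 ≤ length A →
             ∀ {u v w} → All (λ p → p ≢ u × p ≢ v × π p ≡ σ p) A → u ≢ v →
             π u ≡ σ v → π v ≡ σ w → π w ≡ σ u → ⊥
no-3-cycle-fixing-four {π} {σ} π∈ σ∈ A A-distinct 4≤A {u} {v} {w} A-props u≢v πu≡σv πv≡σw πw≡σu =
  let (ps , ps-distinct , ps∈A) = distinctSubvector 4 A A-distinct 4≤A in
  onVector ps ps-distinct (VecAll.map (All.lookup A-props) ps∈A)
  where
  onVector : (ps : Vec (Fin 12) 4) → VecAllPairs.AllPairs _≢_ ps →
             VecAll.All (λ p → p ≢ u × p ≢ v × π p ≡ σ p) ps → ⊥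
  onVector (p₁ ∷ p₂ ∷ p₃ ∷ p₄ ∷ []) ((p₁≢p₂ ∷ p₁≢p₃ ∷ p₁≢p₄ ∷ []) ∷ (p₂≢p₃ ∷ p₂≢p₄ ∷ []) ∷ (p₃≢p₄ ∷ []) ∷ [] ∷ [])
           ((p₁≢u , p₁≢v , a₁) ∷ (p₂≢u , p₂≢v , a₂) ∷ (p₃≢u , p₃≢v , a₃) ∷ (p₄≢u , p₄≢v , a₄) ∷ [])
    = fromImages (Product.map₂ (Product.map₂ ≡⇒Pointwise-≡) (transitive (p₁ ∷ p₂ ∷ p₃ ∷ p₄ ∷ u ∷ [])
        ( (p₁≢p₂ ∷ p₁≢p₃ ∷ p₁≢p₄ ∷ p₁≢u ∷ []) ∷ (p₂≢p₃ ∷ p₂≢p₄ ∷ p₂≢u ∷ []) ∷ (p₃≢p₄ ∷ p₃≢u ∷ [])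
        ∷ (p₄≢u ∷ []) ∷ [] ∷ [])
        (VecAll.universal (λ _ ()) _)))
    where
    fromImages : (∃ λ k → Member k ×
                   Pointwise _≡_ (Vec.map k (11 ∷ 10 ∷ 9 ∷ 8 ∷ 7 ∷ [])) (p₁ ∷ p₂ ∷ p₃ ∷ p₄ ∷ u ∷ [])) → ⊥
    fromImages (k , k∈ , k11 ∷ k10 ∷ k9 ∷ k8 ∷ k7 ∷ []) = u≢v (trans (sym k7) (trans (cong k (sym c≡7)) kc≡v))
      where
      c = proj₁ (Member-surjective k∈ v)
      kc≡v = proj₂ (Member-surjective k∈ v)
      c′ = proj₁ (Member-surjective k∈ w)
      kc′≡w = proj₂ (Member-surjective k∈ w)

      pulledBack : ∀ {q p} → k q ≡ p → π p ≡ σ p → π (k q) ≡ σ (k q)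
      pulledBack kq≡p πp≡σp = trans (cong π kq≡p) (trans πp≡σp (cong σ (sym kq≡p)))

      avoid : ∀ {q p} → k q ≡ p → p ≢ v → c ≢ q
      avoid kq≡p p≢v c≡q = p≢v (trans (sym kq≡p) (trans (cong k (sym c≡q)) kc≡v))

      c∉ : c ∉ 8 ∷ 9 ∷ 10 ∷ 11 ∷ []
      c∉ (here c≡8)                         = avoid k8 p₄≢v c≡8
      c∉ (there (here c≡9))                 = avoid k9 p₃≢v c≡9
      c∉ (there (there (here c≡10)))        = avoid k10 p₂≢v c≡10
      c∉ (there (there (there (here c≡11)))) = avoid k11 p₁≢v c≡11

      c≡7 : c ≡ 7
      c≡7 = no-3-cycle-at-base (Member-∘ π∈ k∈) (Member-∘ σ∈ k∈)
        (pulledBack k11 a₁ ∷ pulledBack k10 a₂ ∷ pulledBack k9 a₃ ∷ pulledBack k8 a₄ ∷ []) c∉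
        (trans (cong π k7) (trans πu≡σv (cong σ (sym kc≡v))))
        (trans (cong π kc≡v) (trans πv≡σw (cong σ (sym kc′≡w))))
        (trans (cong π kc′≡w) (trans πw≡σu (cong σ (sym k7))))

-- Part (a)

F-images-agree : ∀ F {π σ : Permutation′ 12} → Member (π ⟨$⟩ʳ_) → Member (σ ⟨$⟩ʳ_) →
                 (A : List (Fin 12)) → AllPairs _≢_ A → 6 ≤ length A →
                 All (λ x → x ≢ F × tri F π x ≡ tri F σ x) A → π ⟨$⟩ʳ F ≡ σ ⟨$⟩ʳ F
F-images-agree F {π} {σ} π∈ σ∈ A A-distinct 6≤A A-agree =
  decidable-stable (π ⟨$⟩ʳ F ≟ σ ⟨$⟩ʳ F) λ πF≢σF → byMembership πF≢σF (xπ ∈? A) (xσ ∈? A)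
  where
  xπ = π ⟨$⟩ˡ F
  xσ = σ ⟨$⟩ˡ F
  B = without xσ (without xπ A)

  B-distinct : AllPairs _≢_ B
  B-distinct = Unique.filter⁺ _ (Unique.filter⁺ _ A-distinct)

  B-props : All (λ x → x ≢ F × x ≢ xπ × π ⟨$⟩ʳ x ≡ σ ⟨$⟩ʳ x) B
  B-props = All.map (λ (x≢xσ , x≢xπ , x≢F , agree) →
                       x≢F , x≢xπ , trans (sym (tri-other F π x≢F x≢xπ)) (trans agree (tri-other F σ x≢F x≢xσ)))
              (All.zip ( All.all-filter _ (without xπ A)
                       , All.filter⁺ _ (All.zip (All.all-filter _ A , All.filter⁺ _ A-agree))))

  A≤1+Aπ : length A ≤ suc (length (without xπ A))
  A≤1+Aπ = length-without xπ A-distinct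

  Aπ≤1+B : length (without xπ A) ≤ suc (length B)
  Aπ≤1+B = length-without xσ (Unique.filter⁺ _ A-distinct)

  fromFive : π ⟨$⟩ʳ F ≢ σ ⟨$⟩ʳ F → length A ≤ suc (length B) → ⊥
  fromFive πF≢σF A≤1+B = πF≢σF (agreement-on-five⇒≗ π∈ σ∈ B B-distinct (≤-pred (≤-trans 6≤A A≤1+B))
                                                       (All.map (proj₂ ∘ proj₂) B-props) F)

  byMembership : π ⟨$⟩ʳ F ≢ σ ⟨$⟩ʳ F → Dec (xπ ∈ A) → Dec (xσ ∈ A) → ⊥
  byMembership πF≢σF (no xπ∉A) _ =
    fromFive πF≢σF (subst (λ xs → length xs ≤ suc (length B)) (without-∉ xπ∉A) Aπ≤1+B)
  byMembership πF≢σF (yes _) (no xσ∉A) =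
    fromFive πF≢σF (subst (λ xs → length A ≤ suc (length xs))
                          (sym (without-∉ (xσ∉A ∘ proj₁ ∘ ∈-filter⁻ _))) A≤1+Aπ)
  byMembership πF≢σF (yes xπ∈A) (yes xσ∈A) =
    let (xπ≢F , agreeπ) = All.lookup A-agree xπ∈A
        (xσ≢F , agreeσ) = All.lookup A-agree xσ∈A
    in no-3-cycle-fixing-four π∈ σ∈ B B-distinct (≤-pred (≤-pred (≤-trans 6≤A (≤-trans A≤1+Aπ (s≤s Aπ≤1+B)))))
         B-props (≢-sym xπ≢F)
         (sym (proj₂ (disagreeing-preimage {π = π} {σ} πF≢σF xπ≢F refl agreeπ)))
         (trans (inverseʳ π) (sym (inverseʳ σ)))
         (proj₂ (disagreeing-preimage {π = σ} {π} (πF≢σF ∘ sym) xσ≢F refl (sym agreeσ)))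

tri-agreement⇒≗ : ∀ F {π σ : Permutation′ 12} → Member (π ⟨$⟩ʳ_) → Member (σ ⟨$⟩ʳ_) →
                  (A : List (Fin 12)) → AllPairs _≢_ A → 6 ≤ length A →
                  All (λ x → x ≢ F × tri F π x ≡ tri F σ x) A → ∀ x → π ⟨$⟩ʳ x ≡ σ ⟨$⟩ʳ x
tri-agreement⇒≗ F {π} {σ} π∈ σ∈ A A-distinct 6≤A A-agree =
  agreement-on-five⇒≗ π∈ σ∈ A A-distinct (≤-trans (n≤1+n 5) 6≤A)
    (All.map (λ (x≢F , agree) → agreement-if-F-agrees {π = π} {σ} πF≡σF x≢F agree) A-agree)
  where
  πF≡σF : π ⟨$⟩ʳ F ≡ σ ⟨$⟩ʳ F
  πF≡σF = F-images-agree F {π} {σ} π∈ σ∈ A A-distinct 6≤A A-agree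

minusPt-distinct : (F : Fin 12) → AllPairs _≢_ (minusPt F)
minusPt-distinct F = Unique.filter⁺ (λ x → ¬? (x ≟ F)) (Unique.allFin⁺ 12)

minusPt-≢ : (F : Fin 12) → All (_≢ F) (minusPt F)
minusPt-≢ F = All.all-filter (λ x → ¬? (x ≟ F)) (allFin 12)

length-minusPt : (F : Fin 12) → length (minusPt F) ≡ 11
length-minusPt = from-yes (all? λ (F : Fin 12) → length (minusPt F) ℕ.≟ 11)

hdTriMinus-≥6 : (F : Fin 12) → (π σ : Permutation′ 12) → InM12 π → InM12 σ →
                ¬ (∀ x → x ≢ F → tri F π x ≡ tri F σ x) → 6 ≤ hdTriMinus F π σ
hdTriMinus-≥6 F π σ π∈ σ∈ ¬agree = decidable-stable (6 ≤? hdTriMinus F π σ) λ 6≰hd →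
  ¬agree λ x _ → tri-cong F {π} {σ} (tri-agreement⇒≗ F {π} {σ} (InM12⇒Member {π} π∈) (InM12⇒Member {σ} σ∈) A
                               (Unique.filter⁺ agree? (minusPt-distinct F)) (6≤A 6≰hd)
                               (All.zip (All.filter⁺ agree? (minusPt-≢ F) , All.all-filter agree? (minusPt F)))) x
  where
  agree? : (x : Fin 12) → Dec (tri F π x ≡ tri F σ x)
  agree? x = tri F π x ≟ tri F σ x

  A = filter agree? (minusPt F)

  A+hd≡11 : length A + hdTriMinus F π σ ≡ 11
  A+hd≡11 = trans (length-filter-complement agree? (minusPt F)) (length-minusPt F)

  6≤A : ¬ 6 ≤ hdTriMinus F π σ → 6 ≤ length A
  6≤A 6≰hd = +-cancelʳ-≤ 5 6 (length A)
    (subst (_≤ length A + 5) A+hd≡11 (+-monoʳ-≤ (length A) (≤-pred (≰⇒> 6≰hd))))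

-- Part (b)

triMinus : Word → Permutation′ 11
triMinus w = remove 11 (triPerm 11 (evalWord w))

-- minusPt 11 computes to map (punchIn 11) (allFin 11).
hd-triMinus : ∀ w w′ → hd (triMinus w) (triMinus w′) ≡ hdTriMinus 11 (evalWord w) (evalWord w′)
hd-triMinus w w′ = trans
  (hd-remove 11 (triPerm 11 (evalWord w)) (triPerm 11 (evalWord w′))
             (transpose-matchˡ (act w 11) 11) (transpose-matchˡ (act w′ 11) 11))
  (hdOn-cong (minusPt 11) (sym ∘ tri≡triPerm 11 (evalWord w)) (sym ∘ tri≡triPerm 11 (evalWord w′)))

triMinus-separates : ∀ {w w′} → Distinct w w′ → 6 ≤ hd (triMinus w) (triMinus w′)
triMinus-separates {w} {w′} w≉w′ = subst (6 ≤_) (sym (hd-triMinus w w′))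
  (hdTriMinus-≥6 11 (evalWord w) (evalWord w′) (w , λ _ → refl) (w′ , λ _ → refl) λ agree →
    w≉w′ (tri-agreement⇒≗ 11 {evalWord w} {evalWord w′} (act-member w) (act-member w′)
                          (minusPt 11) (minusPt-distinct 11) (m≤m+n 6 5)
            (All.map (λ {x} x≢F → x≢F , agree x x≢F) (minusPt-≢ 11))))

atLeast : ∀ {n d} (C : List (Permutation′ n)) → AllPairs (λ π σ → d ≤ hd π σ) C → MAtLeast n d (length C)
atLeast C C-pairs = C , ≤-refl , C-pairs

M₁₁,₆≥95040 : MAtLeast 11 6 95040
M₁₁,₆≥95040 = subst (MAtLeast 11 6) (trans (length-map triMinus elements) length-elements)
  (atLeast (map triMinus elements)
    (AllPairs.map⁺ {f = triMinus} {xs = elements}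
      (AllPairs.map (λ {w} {w′} → triMinus-separates {w} {w′}) elements-distinct)))

-- Part (c)

-- π^△ 10 is the image of π 10 under the transposition of π 11 and 11, so for π 11 = a
-- it is 10 exactly when π 10 = PC.transpose 11 a 10, which fixes the level-2 coset.
secondPoint : Fin 12 → Fin 12
secondPoint a = Cosets₁.coset⁻¹ a (PC.transpose 11 a 10)

secondPoint-moved : ∀ a → secondPoint a ∉ 11 ∷ []
secondPoint-moved = from-yes (all? λ a → secondPoint a ∉? (11 ∷ []))

secondBlock : Fin 12 → List Word
secondBlock a = Cosets₂.cosetWords (secondPoint a ∷ []) (λ _ → Stabiliser.elements G₃)

secondBlock-member : ∀ a → All (Stabiliser.Member G₂ ∘ act) (secondBlock a)
secondBlock-member a = Cosets₂.cosetWords-member {as = secondPoint a ∷ []} (λ _ → Stabiliser.elements G₃)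
  (secondPoint-moved a ∷ []) (λ _ → Stabiliser.elements-member G₃)

secondBlock-10 : ∀ a → All (λ u → act u 10 ≡ secondPoint a) (secondBlock a)
secondBlock-10 a = Cosets₂.cosetWords-All {P = λ u → act u 10 ≡ secondPoint a} {as = secondPoint a ∷ []}
  (λ _ → Stabiliser.elements G₃)
  (All.map (λ {w} w∈ → Cosets₂.member-base (Cosets₂.cosetWord-member w (secondPoint-moved a) w∈))
           (Stabiliser.elements-member G₃) ∷ [])

fixers₁₀ : List Word
fixers₁₀ = Cosets₁.cosetWords (allFin 12) secondBlock

tri-fixes-10 : ∀ a {u} → Stabiliser.Member G₂ (act u) → act u 10 ≡ secondPoint a →
               tri 11 (evalWord (u ++ cosetWord₁ a)) 10 ≡ 10
tri-fixes-10 a {u} u∈ u10≡ = begin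
  tri 11 π 10                                 ≡⟨ tri≡triPerm 11 π 10 ⟩
  PC.transpose (π ⟨$⟩ʳ 11) 11 (π ⟨$⟩ʳ 10)   ≡⟨ cong₂ (λ p q → PC.transpose p 11 q) π11≡a π10≡ ⟩
  PC.transpose a 11 (PC.transpose 11 a 10)    ≡⟨ PC.transpose-inverse a 11 ⟩
  10                                          ∎
  where
  open ≡-Reasoning
  π = evalWord (u ++ cosetWord₁ a)
  π11≡a : π ⟨$⟩ʳ 11 ≡ a
  π11≡a = Cosets₁.member-base (Cosets₁.cosetWord-member u (λ ()) u∈)
  π10≡ : π ⟨$⟩ʳ 10 ≡ PC.transpose 11 a 10
  π10≡ = begin
    act (u ++ cosetWord₁ a) 10          ≡⟨ act-++ u (cosetWord₁ a) 10 ⟩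
    act (cosetWord₁ a) (act u 10)       ≡⟨ cong (act (cosetWord₁ a)) u10≡ ⟩
    act (cosetWord₁ a) (secondPoint a)  ≡⟨ Cosets₁.coset≗act a _ ⟨
    Cosets₁.coset a (secondPoint a)       ≡⟨ Cosets₁.coset-coset⁻¹ a _ ⟩
    PC.transpose 11 a 10                ∎

triMinus-fixes-10 : ∀ v → tri 11 (evalWord v) 10 ≡ 10 → triMinus v ⟨$⟩ʳ 10 ≡ 10
triMinus-fixes-10 v tri10≡10 = punchIn-injective 11 _ _ (begin
  punchIn 11 (triMinus v ⟨$⟩ʳ 10)   ≡⟨ remove-punchIn (triPerm 11 (evalWord v)) (transpose-matchˡ (act v 11) 11) 10 ⟨
  triPerm 11 (evalWord v) ⟨$⟩ʳ 10   ≡⟨ tri≡triPerm 11 (evalWord v) 10 ⟨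
  tri 11 (evalWord v) 10            ≡⟨ tri10≡10 ⟩
  10                                ∎)
  where open ≡-Reasoning

-- allFin 11 computes to map (punchIn 10) (allFin 10) ++ 10 ∷ [].
hd-remove-10 : ∀ (ρ ρ′ : Permutation′ 11) → ρ ⟨$⟩ʳ 10 ≡ 10 → ρ′ ⟨$⟩ʳ 10 ≡ 10 →
               hd (remove 10 ρ) (remove 10 ρ′) ≡ hd ρ ρ′
hd-remove-10 ρ ρ′ ρ10≡10 ρ′10≡10 = begin
  hd (remove 10 ρ) (remove 10 ρ′)                  ≡⟨ hd-remove 10 ρ ρ′ ρ10≡10 ρ′10≡10 ⟩
  hdOn D ρ̂ ρ̂′                                      ≡⟨ +-identityʳ _ ⟨
  hdOn D ρ̂ ρ̂′ + 0                                  ≡⟨ cong (hdOn D ρ̂ ρ̂′ +_) agree-at-10 ⟨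
  hdOn D ρ̂ ρ̂′ + hdOn (10 ∷ []) ρ̂ ρ̂′                ≡⟨ hdOn-++ D (10 ∷ []) ρ̂ ρ̂′ ⟨
  hd ρ ρ′                                          ∎
  where
  open ≡-Reasoning
  D = map (punchIn 10) (allFin 10)
  ρ̂ = ρ ⟨$⟩ʳ_
  ρ̂′ = ρ′ ⟨$⟩ʳ_
  agree-at-10 : hdOn (10 ∷ []) ρ̂ ρ̂′ ≡ 0
  agree-at-10 = hdOn-agreeing {D = 10 ∷ []} {ρ̂} {ρ̂′} (trans ρ10≡10 (sym ρ′10≡10) ∷ [])

fixers₁₀-fix : All (λ v → triMinus v ⟨$⟩ʳ 10 ≡ 10) fixers₁₀
fixers₁₀-fix = Cosets₁.cosetWords-All {P = λ v → triMinus v ⟨$⟩ʳ 10 ≡ 10} {as = allFin _} secondBlock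
  (All.tabulate λ {a} _ →
    All.map (λ {u} (u∈ , u10≡) → triMinus-fixes-10 (u ++ cosetWord₁ a) (tri-fixes-10 a {u} u∈ u10≡))
            (All.zip (secondBlock-member a , secondBlock-10 a)))

fixers₁₀-distinct : AllPairs Distinct fixers₁₀
fixers₁₀-distinct = Cosets₁.cosetWords-distinct {as = allFin _} secondBlock (Unique.allFin⁺ 12) (All.tabulate λ _ ())
  secondBlock-member
  (λ a → Cosets₂.cosetWords-distinct {as = secondPoint a ∷ []} (λ _ → Stabiliser.elements G₃) ([] ∷ [])
           (secondPoint-moved a ∷ []) (λ _ → Stabiliser.elements-member G₃) (λ _ → Stabiliser.elements-distinct G₃))

length-fixers₁₀ : length fixers₁₀ ≡ 8640
length-fixers₁₀ = Cosets₁.length-cosetWords (allFin _) secondBlock λ a →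
  Cosets₂.length-cosetWords (secondPoint a ∷ []) (λ _ → Stabiliser.elements G₃) (λ _ → Stabiliser.length-elements G₃)

triMinus₁₀ : Word → Permutation′ 10
triMinus₁₀ w = remove 10 (triMinus w)

M₁₀,₆≥8640 : MAtLeast 10 6 8640
M₁₀,₆≥8640 = subst (MAtLeast 10 6) (trans (length-map triMinus₁₀ fixers₁₀) length-fixers₁₀)
  (atLeast (map triMinus₁₀ fixers₁₀)
    (AllPairs.map⁺ {f = triMinus₁₀} {xs = fixers₁₀}
      (AllPairs.map (λ {v} {v′} (v10 , v′10 , v≉v′) →
                       subst (6 ≤_) (sym (hd-remove-10 (triMinus v) (triMinus v′) v10 v′10))
                             (triMinus-separates {v} {v′} v≉v′))
                    (allPairs-withAll fixers₁₀-fix fixers₁₀-distinct))))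

proposition17 : ((F : Fin 12) → (π σ : Permutation′ 12) → InM12 π → InM12 σ →
      ¬ (∀ x → x ≢ F → tri F π x ≡ tri F σ x) →
      6 ≤ hdTriMinus F π σ)
    × MAtLeast 11 6 95040
    × MAtLeast 10 6 8640
proposition17 = hdTriMinus-≥6 , M₁₁,₆≥95040 , M₁₀,₆≥8640
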